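{- Let $G$ be a triangle-free graph, and let $H_G$ be the graph with $V(H_G)=V(G)\cup\{a,b,c,d\}$ (four new vertices) and $E(H_G)=E(G)\cup\{ab,cd\}\cup E'$, where $E'=\{bv : v\in V(G)\}\cup\{cv : v\in V(G)\}$. Then there is a line geodetic set $Q$ of $H_G$ of minimum cardinality such that $Q\cap E'=\emptyset$.
   Context: For a graph $H$ and edges $e,e'\in E(H)$, distances and (shortest) paths between edges are taken in the line graph $L(H)$ (whose vertices are the edges of $H$, two being adjacent iff they share an endpoint). A set $S\subseteq E(H)$ is a line geodetic set of $H$ if every edge $e\in E(H)\setminus S$ lies on some shortest path (in $L(H)$) between some pair of edges of $S$; equivalently, $S$ is a geodetic set of $L(H)$, where a set $X$ of vertices of a graph is geodetic if every vertex lies on a shortest path between two vertices of $X$. -}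

module Defs where

open import Data.Nat using (ℕ; zero; suc; _+_; _<_; _≤_)
open import Data.Nat.Properties using (_<?_)
open import Data.Fin using (Fin; toℕ; splitAt; _↑ˡ_; _↑ʳ_)
open import Data.Fin.Base using () renaming (zero to f0; suc to fs)
open import Data.Bool using (Bool; true; false; _∧_; if_then_else_)
open import Data.Sum using (_⊎_; inj₁; inj₂)
open import Data.Product using (Σ; _×_; _,_; ∃-syntax)
open import Data.List using (List; map; allFin)
open import Data.Nat.ListAction using (sum)
open import Relation.Binary.PropositionalEquality using (_≡_; _≢_; refl)
open import Relation.Nullary using (¬_)
open import Relation.Nullary.Decidable using (⌊_⌋)

record Graph : Set where
  field
    n     : ℕ
    Adj   : Fin n → Fin n → Bool
    sym   : ∀ x y → Adj x y ≡ Adj y x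
    irrefl : ∀ x → Adj x x ≡ false

open Graph public

-- Triangle-free: no three (necessarily distinct) pairwise adjacent vertices.
TriangleFree : Graph → Set
TriangleFree G = ¬ (∃[ x ] ∃[ y ] ∃[ z ]
  (Adj G x y ≡ true × Adj G y z ≡ true × Adj G x z ≡ true))

record Edge (G : Graph) : Set where
  constructor edge
  field
    lo    : Fin (n G)
    hi    : Fin (n G)
    lo<hi : toℕ lo < toℕ hi
    adj   : Adj G lo hi ≡ true

open Edge public

SameEdge : {G : Graph} → Edge G → Edge G → Set
SameEdge e f = (lo e ≡ lo f) × (hi e ≡ hi f)

ShareEnd : {G : Graph} → Edge G → Edge G → Set
ShareEnd e f = (lo e ≡ lo f) ⊎ (lo e ≡ hi f) ⊎ (hi e ≡ lo f) ⊎ (hi e ≡ hi f)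

LAdj : {G : Graph} → Edge G → Edge G → Set
LAdj e f = ¬ SameEdge e f × ShareEnd e f

data LWalk {G : Graph} : Edge G → Edge G → ℕ → Set where
  here : (e : Edge G) → LWalk e e zero
  step : ∀ {e f g k} → LAdj e f → LWalk f g k → LWalk e g (suc k)

OnWalk : {G : Graph} {e f : Edge G} {k : ℕ} → Edge G → LWalk e f k → Set
OnWalk x (here e) = SameEdge x e
OnWalk {e = e} x (step _ w) = SameEdge x e ⊎ OnWalk x w

OnShortestPath : {G : Graph} → Edge G → Edge G → Edge G → Set
OnShortestPath {G} x s t =
  Σ ℕ λ k → Σ (LWalk s t k) λ w → OnWalk x w ×
    (∀ k' → LWalk s t k' → k ≤ k')

-- Sets of edges of G, given by a Bool-valued function on vertex pairs,
-- read on normalised pairs (lo, hi).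
EdgeSet : Graph → Set
EdgeSet G = Fin (n G) → Fin (n G) → Bool

_∈E_ : {G : Graph} → Edge G → EdgeSet G → Set
e ∈E S = S (lo e) (hi e) ≡ true

card : (G : Graph) → EdgeSet G → ℕ
card G S = sum (map (λ u → sum (map (λ v →
  if ⌊ toℕ u <? toℕ v ⌋ ∧ Adj G u v ∧ S u v then 1 else 0)
  (allFin (n G)))) (allFin (n G)))

LineGeodetic : (G : Graph) → EdgeSet G → Set
LineGeodetic G S = ∀ (e : Edge G) → ¬ (e ∈E S) →
  ∃[ s ] ∃[ t ] (s ∈E S × t ∈E S × OnShortestPath e s t)

MinLineGeodetic : (G : Graph) → EdgeSet G → Set
MinLineGeodetic G S = LineGeodetic G S × (∀ S' → LineGeodetic G S' → card G S ≤ card G S')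

-- The construction H_G.  Vertices: Fin (n + 4); the vertices of G are
-- (v ↑ˡ 4), and a, b, c, d are raise n 0, raise n 1, raise n 2, raise n 3.

newAdj : Fin 4 → Fin 4 → Bool
newAdj f0 (fs f0) = true
newAdj (fs f0) f0 = true
newAdj (fs (fs f0)) (fs (fs (fs f0))) = true
newAdj (fs (fs (fs f0))) (fs (fs f0)) = true
newAdj _ _ = false

isBC : Fin 4 → Bool
isBC (fs f0) = true
isBC (fs (fs f0)) = true
isBC _ = false

HAdj : (G : Graph) → Fin (n G + 4) → Fin (n G + 4) → Bool
HAdj G x y with splitAt (n G) x | splitAt (n G) y
... | inj₁ u | inj₁ v = Adj G u v
... | inj₁ u | inj₂ j = isBC j
... | inj₂ i | inj₁ v = isBC i
... | inj₂ i | inj₂ j = newAdj i j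

newAdj-sym : ∀ i j → newAdj i j ≡ newAdj j i
newAdj-sym f0 f0 = refl
newAdj-sym f0 (fs f0) = refl
newAdj-sym f0 (fs (fs f0)) = refl
newAdj-sym f0 (fs (fs (fs f0))) = refl
newAdj-sym (fs f0) f0 = refl
newAdj-sym (fs f0) (fs f0) = refl
newAdj-sym (fs f0) (fs (fs f0)) = refl
newAdj-sym (fs f0) (fs (fs (fs f0))) = refl
newAdj-sym (fs (fs f0)) f0 = refl
newAdj-sym (fs (fs f0)) (fs f0) = refl
newAdj-sym (fs (fs f0)) (fs (fs f0)) = refl
newAdj-sym (fs (fs f0)) (fs (fs (fs f0))) = refl
newAdj-sym (fs (fs (fs f0))) f0 = refl
newAdj-sym (fs (fs (fs f0))) (fs f0) = refl
newAdj-sym (fs (fs (fs f0))) (fs (fs f0)) = refl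
newAdj-sym (fs (fs (fs f0))) (fs (fs (fs f0))) = refl

newAdj-irr : ∀ i → newAdj i i ≡ false
newAdj-irr f0 = refl
newAdj-irr (fs f0) = refl
newAdj-irr (fs (fs f0)) = refl
newAdj-irr (fs (fs (fs f0))) = refl

HAdj-sym : (G : Graph) → ∀ x y → HAdj G x y ≡ HAdj G y x
HAdj-sym G x y with splitAt (n G) x | splitAt (n G) y
... | inj₁ u | inj₁ v = sym G u v
... | inj₁ u | inj₂ j = refl
... | inj₂ i | inj₁ v = refl
... | inj₂ i | inj₂ j = newAdj-sym i j

HAdj-irr : (G : Graph) → ∀ x → HAdj G x x ≡ false
HAdj-irr G x with splitAt (n G) x
... | inj₁ u = irrefl G u
... | inj₂ i = newAdj-irr i

H : Graph → Graph
H G = record { n = n G + 4 ; Adj = HAdj G ; sym = HAdj-sym G ; irrefl = HAdj-irr G }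

-- E' = {bv, cv : v ∈ V(G)}; as normalised pairs these are ((v ↑ˡ 4), raise n 1)
-- and ((v ↑ˡ 4), raise n 2).  Q ∩ E' = ∅:
DisjointE' : (G : Graph) → EdgeSet (H G) → Set
DisjointE' G Q = ∀ (v : Fin (n G)) →
  (Q ((v ↑ˡ 4)) ((n G ↑ʳ fs f0)) ≡ false) ×
  (Q ((v ↑ˡ 4)) ((n G ↑ʳ fs (fs f0))) ≡ false)

module Submission where

-- Module Exchange proves the key step: a spoke at v in a line
-- geodetic set may be replaced by an edge vz of G (or simply dropped if v is
-- isolated) without losing geodeticity or increasing the size, because G has
-- no triangle.  Clearing the spokes vertex by vertex from a minimum line
-- geodetic set proves lemma2.

open import Defs hiding (sym)
open import Axiom.UniquenessOfIdentityProofs using (module Decidable⇒UIP)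
open import Data.Bool using (Bool; true; false; _∧_; if_then_else_)
import Data.Bool.Properties as BoolP
open import Data.Empty using (⊥; ⊥-elim)
open import Data.Fin using (Fin; toℕ; fromℕ<; combine; remQuot; splitAt; _↑ˡ_; _↑ʳ_)
open import Data.Fin.Patterns using (0F; 1F; 2F; 3F)
import Data.Fin.Properties as FinP
open import Data.Fin.Subset using (Subset)
open import Data.Fin.Subset.Properties using (anySubset?)
open import Data.List using (map; allFin)
import Data.List as List
import Data.List.Properties as ListP
open import Data.Nat using (ℕ; zero; suc; _+_; _*_; _<_; _≤_; z≤n; s≤s)
import Data.Nat.Properties as ℕP
open import Data.Nat.ListAction using (sum)
open import Data.Product using (Σ; ∃; ∃-syntax; _×_; _,_; proj₁; proj₂; uncurry)
open import Data.Sum using (_⊎_; inj₁; inj₂; [_,_]′)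
open import Data.Vec using (lookup; tabulate)
open import Data.Vec.Properties using (lookup∘tabulate)
open import Function using (_∘_; id)
open import Relation.Binary.Definitions using (tri<; tri≈; tri>)
open import Relation.Binary.PropositionalEquality
open import Relation.Nullary using (¬_; Dec; yes; no)
open import Relation.Nullary.Decidable using (⌊_⌋; _×-dec_; _⊎-dec_; ¬?; _→-dec_; map′; decidable-stable)

sumFin : (k : ℕ) → (Fin k → ℕ) → ℕ
sumFin zero    f = 0
sumFin (suc k) f = f Fin.zero + sumFin k (f ∘ Fin.suc)

sum-allFin : (k : ℕ) (f : Fin k → ℕ) → sum (map f (allFin k)) ≡ sumFin k f
sum-allFin k f = trans (cong sum (ListP.map-tabulate id f)) (sum-tabulate k)
  where
  sum-tabulate : ∀ k {f : Fin k → ℕ} → sum (List.tabulate f) ≡ sumFin k f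
  sum-tabulate zero        = refl
  sum-tabulate (suc k) {f} = cong (f Fin.zero +_) (sum-tabulate k)

sumFin-cong : ∀ k {f g : Fin k → ℕ} → (∀ i → f i ≡ g i) → sumFin k f ≡ sumFin k g
sumFin-cong zero    f≡g = refl
sumFin-cong (suc k) f≡g = cong₂ _+_ (f≡g Fin.zero) (sumFin-cong k (f≡g ∘ Fin.suc))

sumFin-mono : ∀ k {f g : Fin k → ℕ} → (∀ i → f i ≤ g i) → sumFin k f ≤ sumFin k g
sumFin-mono zero    f≤g = z≤n
sumFin-mono (suc k) f≤g = ℕP.+-mono-≤ (f≤g Fin.zero) (sumFin-mono k (f≤g ∘ Fin.suc))

sumFin-point : ∀ k {f g : Fin k → ℕ} (i₀ : Fin k) {a b : ℕ} →
  (∀ i → i ≢ i₀ → f i ≤ g i) → a + f i₀ ≤ b + g i₀ → a + sumFin k f ≤ b + sumFin k g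
sumFin-point (suc k) {f} {g} Fin.zero {a} {b} others at-i₀ = begin
  a + (f Fin.zero + sumFin k (f ∘ Fin.suc))  ≡⟨ ℕP.+-assoc a (f Fin.zero) _ ⟨
  (a + f Fin.zero) + sumFin k (f ∘ Fin.suc)  ≤⟨ ℕP.+-mono-≤ at-i₀ (sumFin-mono k (λ i → others (Fin.suc i) λ ())) ⟩
  (b + g Fin.zero) + sumFin k (g ∘ Fin.suc)  ≡⟨ ℕP.+-assoc b (g Fin.zero) _ ⟩
  b + (g Fin.zero + sumFin k (g ∘ Fin.suc))  ∎
  where open ℕP.≤-Reasoning
sumFin-point (suc k) {f} {g} (Fin.suc i₀) {a} {b} others at-i₀ = begin
  a + (f Fin.zero + sumFin k (f ∘ Fin.suc))  ≡⟨ swap-front a (f Fin.zero) _ ⟩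
  f Fin.zero + (a + sumFin k (f ∘ Fin.suc))  ≤⟨ ℕP.+-mono-≤ (others Fin.zero λ ())
      (sumFin-point k i₀ (λ i i≢i₀ → others (Fin.suc i) (i≢i₀ ∘ FinP.suc-injective)) at-i₀) ⟩
  g Fin.zero + (b + sumFin k (g ∘ Fin.suc))  ≡⟨ swap-front b (g Fin.zero) _ ⟨
  b + (g Fin.zero + sumFin k (g ∘ Fin.suc))  ∎
  where
  open ℕP.≤-Reasoning
  swap-front : ∀ a x y → a + (x + y) ≡ x + (a + y)
  swap-front a x y = trans (sym (ℕP.+-assoc a x y)) (trans (cong (_+ y) (ℕP.+-comm a x)) (ℕP.+-assoc x a y))

false≢true : false ≢ true
false≢true ()

module _ {K : Graph} where

  Incident : Edge K → Fin (n K) → Set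
  Incident e p = (lo e ≡ p) ⊎ (hi e ≡ p)

  -- An edge is determined by its endpoints (the remaining fields are
  -- proof-irrelevant).
  edge-ext : (e f : Edge K) → lo e ≡ lo f → hi e ≡ hi f → e ≡ f
  edge-ext (edge l h p q) (edge .l .h p′ q′) refl refl =
    cong₂ (edge l h) (ℕP.≤-irrelevant p p′) (Decidable⇒UIP.≡-irrelevant BoolP._≟_ q q′)

  SameEdge⇒≡ : {e f : Edge K} → SameEdge e f → e ≡ f
  SameEdge⇒≡ {e} {f} (l≡ , h≡) = edge-ext e f l≡ h≡

  ≡⇒SameEdge : {e f : Edge K} → e ≡ f → SameEdge e f
  ≡⇒SameEdge refl = refl , refl

  _≟E_ : (e f : Edge K) → Dec (e ≡ f)
  e ≟E f = map′ SameEdge⇒≡ ≡⇒SameEdge ((lo e FinP.≟ lo f) ×-dec (hi e FinP.≟ hi f))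

  share⇒common : {e f : Edge K} → ShareEnd e f → ∃[ p ] Incident e p × Incident f p
  share⇒common {e} (inj₁ l≡l)               = lo e , inj₁ refl , inj₁ (sym l≡l)
  share⇒common {e} (inj₂ (inj₁ l≡h))        = lo e , inj₁ refl , inj₂ (sym l≡h)
  share⇒common {e} (inj₂ (inj₂ (inj₁ h≡l))) = hi e , inj₂ refl , inj₁ (sym h≡l)
  share⇒common {e} (inj₂ (inj₂ (inj₂ h≡h))) = hi e , inj₂ refl , inj₂ (sym h≡h)

  common⇒share : {e f : Edge K} {p : Fin (n K)} → Incident e p → Incident f p → ShareEnd e f
  common⇒share (inj₁ a) (inj₁ b) = inj₁ (trans a (sym b))
  common⇒share (inj₁ a) (inj₂ b) = inj₂ (inj₁ (trans a (sym b)))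
  common⇒share (inj₂ a) (inj₁ b) = inj₂ (inj₂ (inj₁ (trans a (sym b))))
  common⇒share (inj₂ a) (inj₂ b) = inj₂ (inj₂ (inj₂ (trans a (sym b))))

  adjacent-at : {e f : Edge K} {p : Fin (n K)} → Incident e p → Incident f p → e ≢ f → LAdj e f
  adjacent-at {e} {f} ie if e≢f = (λ same → e≢f (SameEdge⇒≡ same)) , common⇒share {e} {f} ie if

  LAdj-sym : {e f : Edge K} → LAdj e f → LAdj f e
  LAdj-sym {e} {f} (not-same , share) with share⇒common {e} {f} share
  ... | _ , ie , if = adjacent-at {f} {e} if ie (λ f≡e → not-same (≡⇒SameEdge (sym f≡e)))

  Near : Edge K → Edge K → Set
  Near e f = (e ≡ f) ⊎ LAdj e f

  near-at : {e f : Edge K} {p : Fin (n K)} → Incident e p → Incident f p → Near e f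
  near-at {e} {f} ie if with e ≟E f
  ... | yes e≡f = inj₁ e≡f
  ... | no  e≢f = inj₂ (adjacent-at {e} {f} ie if e≢f)

  Near-sym : {e f : Edge K} → Near e f → Near f e
  Near-sym (inj₁ refl) = inj₁ refl
  Near-sym {e} {f} (inj₂ a) = inj₂ (LAdj-sym {e} {f} a)

  endpoints-adjacent : {e : Edge K} {p q : Fin (n K)} →
    Incident e p → Incident e q → p ≢ q → Adj K p q ≡ true
  endpoints-adjacent     (inj₁ a)    (inj₁ b)    p≢q = ⊥-elim (p≢q (trans (sym a) b))
  endpoints-adjacent {e} (inj₁ refl) (inj₂ refl) _   = adj e
  endpoints-adjacent {e} (inj₂ refl) (inj₁ refl) _   = trans (Graph.sym K (hi e) (lo e)) (adj e)
  endpoints-adjacent     (inj₂ a)    (inj₂ b)    p≢q = ⊥-elim (p≢q (trans (sym a) b))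

  only-two-endpoints : {e : Edge K} {p q r : Fin (n K)} →
    Incident e p → Incident e q → p ≢ q → Incident e r → (r ≡ p) ⊎ (r ≡ q)
  only-two-endpoints (inj₁ a) (inj₁ b) p≢q _        = ⊥-elim (p≢q (trans (sym a) b))
  only-two-endpoints (inj₂ a) (inj₂ b) p≢q _        = ⊥-elim (p≢q (trans (sym a) b))
  only-two-endpoints (inj₁ a) (inj₂ b) _   (inj₁ c) = inj₁ (trans (sym c) a)
  only-two-endpoints (inj₁ a) (inj₂ b) _   (inj₂ c) = inj₂ (trans (sym c) b)
  only-two-endpoints (inj₂ a) (inj₁ b) _   (inj₁ c) = inj₂ (trans (sym c) b)
  only-two-endpoints (inj₂ a) (inj₁ b) _   (inj₂ c) = inj₁ (trans (sym c) a)

  -- Two edges with the same two (distinct) endpoints are equal; the mixed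
  -- cases contradict the normalisation lo < hi.
  edge-by-endpoints : {e f : Edge K} {p q : Fin (n K)} →
    Incident e p → Incident e q → Incident f p → Incident f q → p ≢ q → e ≡ f
  edge-by-endpoints (inj₁ a) (inj₁ b) _ _ p≢q = ⊥-elim (p≢q (trans (sym a) b))
  edge-by-endpoints (inj₂ a) (inj₂ b) _ _ p≢q = ⊥-elim (p≢q (trans (sym a) b))
  edge-by-endpoints _ _ (inj₁ a) (inj₁ b) p≢q = ⊥-elim (p≢q (trans (sym a) b))
  edge-by-endpoints _ _ (inj₂ a) (inj₂ b) p≢q = ⊥-elim (p≢q (trans (sym a) b))
  edge-by-endpoints {e} {f} (inj₁ a) (inj₂ b) (inj₁ c) (inj₂ d) _ =
    edge-ext e f (trans a (sym c)) (trans b (sym d))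
  edge-by-endpoints {e} {f} (inj₂ a) (inj₁ b) (inj₂ c) (inj₁ d) _ =
    edge-ext e f (trans b (sym d)) (trans a (sym c))
  edge-by-endpoints {e} {f} (inj₁ refl) (inj₂ refl) (inj₂ c) (inj₁ d) _ =
    ⊥-elim (ℕP.<-asym (lo<hi e) (subst₂ (λ u v → toℕ u < toℕ v) d c (lo<hi f)))
  edge-by-endpoints {e} {f} (inj₂ refl) (inj₁ refl) (inj₁ c) (inj₂ d) _ =
    ⊥-elim (ℕP.<-asym (lo<hi e) (subst₂ (λ u v → toℕ u < toℕ v) c d (lo<hi f)))

  edge-between : (x y : Fin (n K)) → Adj K x y ≡ true → Σ (Edge K) λ e → Incident e x × Incident e y
  edge-between x y a with ℕP.<-cmp (toℕ x) (toℕ y)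
  ... | tri< x<y _ _ = edge x y x<y a , inj₁ refl , inj₂ refl
  ... | tri> _ _ y<x = edge y x y<x (trans (Graph.sym K y x) a) , inj₂ refl , inj₁ refl
  ... | tri≈ _ x≡y _ with FinP.toℕ-injective x≡y
  ...   | refl with trans (sym a) (irrefl K x)
  ...     | ()

  walk-zero : {s t : Edge K} → LWalk s t 0 → s ≡ t
  walk-zero (here _) = refl

  walk-one : {s t : Edge K} → LWalk s t 1 → LAdj s t
  walk-one (step s~t (here _)) = s~t

  snoc : {s t : Edge K} {k : ℕ} → LWalk s t k → (u : Edge K) → LAdj t u → LWalk s u (suc k)
  snoc (here _)   u t~u = step t~u (here u)
  snoc (step p w) u t~u = step p (snoc w u t~u)

  snoc-keeps : {s t x : Edge K} {k : ℕ} (w : LWalk s t k) (u : Edge K) (t~u : LAdj t u) →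
    OnWalk x w → OnWalk x (snoc w u t~u)
  snoc-keeps (here _)   u t~u on       = inj₁ on
  snoc-keeps (step p w) u t~u (inj₁ on) = inj₁ on
  snoc-keeps (step p w) u t~u (inj₂ on) = inj₂ (snoc-keeps w u t~u on)

  snoc-adds : {s t x : Edge K} {k : ℕ} (w : LWalk s t k) (u : Edge K) (t~u : LAdj t u) →
    SameEdge x u → OnWalk x (snoc w u t~u)
  snoc-adds (here _)   u t~u same = inj₂ same
  snoc-adds (step p w) u t~u same = inj₂ (snoc-adds w u t~u same)

  reverse : {s t : Edge K} {k : ℕ} → LWalk s t k → LWalk t s k
  reverse (here e) = here e
  reverse {s} (step {f = f} p w) = snoc (reverse w) s (LAdj-sym {s} {f} p)

  reverse-keeps : {s t x : Edge K} {k : ℕ} (w : LWalk s t k) → OnWalk x w → OnWalk x (reverse w)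
  reverse-keeps (here e) on = on
  reverse-keeps {s} (step {f = f} p w) (inj₁ on) = snoc-adds (reverse w) s (LAdj-sym {s} {f} p) on
  reverse-keeps {s} (step {f = f} p w) (inj₂ on) =
    snoc-keeps (reverse w) s (LAdj-sym {s} {f} p) (reverse-keeps w on)

  OnShortestPath-sym : {x s t : Edge K} → OnShortestPath x s t → OnShortestPath x t s
  OnShortestPath-sym (k , w , on , shortest) =
    k , reverse w , reverse-keeps w on , λ k′ w′ → shortest k′ (reverse w′)

  WalkWithin : Edge K → Edge K → ℕ → Set
  WalkWithin s t b = Σ ℕ λ k → k ≤ b × LWalk s t k

  near-walk : {s t : Edge K} → Near s t → WalkWithin s t 1
  near-walk {s} (inj₁ refl) = 0 , z≤n , here s
  near-walk {t = t} (inj₂ s~t) = 1 , s≤s z≤n , step s~t (here t)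

  prepend-near : {s t u : Edge K} {b : ℕ} → Near s t → WalkWithin t u b → WalkWithin s u (suc b)
  prepend-near (inj₁ refl) (k , k≤b , w) = k , ℕP.m≤n⇒m≤1+n k≤b , w
  prepend-near (inj₂ s~t)  (k , k≤b , w) = suc k , s≤s k≤b , step s~t w

  meet-at : {e f t : Edge K} {p : Fin (n K)} → Incident e p → Incident f p → Near f t → WalkWithin e t 2
  meet-at {e} {f} {t} ep fp f≈t = prepend-near {e} {f} (near-at {e} {f} ep fp) (near-walk {f} {t} f≈t)

  pass-through : {s e f t : Edge K} {p : Fin (n K)} →
    Near s e → Incident e p → Incident f p → Near f t → WalkWithin s t 3
  pass-through {s} {e} s≈e ep fp f≈t = prepend-near {s} {e} s≈e (meet-at {e} ep fp f≈t)

  -- Let x = pq be the only edge at p.  Every neighbour of x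
  -- in L(K) passes through q, so any two neighbours of x are at distance at
  -- most one: x can be cut out of any walk through it, and therefore lies on
  -- a shortest path only as one of its ends.
  module Pendant (x : Edge K) (p q : Fin (n K)) (xp : Incident x p) (xq : Incident x q)
                 (p≢q : p ≢ q) (only-x : ∀ f → Incident f p → f ≡ x) where

    neighbour-through-q : (f : Edge K) → LAdj f x → Incident f q
    neighbour-through-q f (not-same , share) with share⇒common {f} {x} share
    ... | r , fr , xr with only-two-endpoints {x} xp xq p≢q xr
    ...   | inj₁ refl = ⊥-elim (not-same (≡⇒SameEdge (only-x f fr)))
    ...   | inj₂ refl = fr

    shortcut : {s t : Edge K} {k : ℕ} (w : LWalk s t k) → OnWalk x w → x ≢ s → x ≢ t →
      Σ ℕ λ k′ → k′ < k × LWalk s t k′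
    shortcut (here _) on x≢s _ = ⊥-elim (x≢s (SameEdge⇒≡ on))
    shortcut (step _ _) (inj₁ on) x≢s _ = ⊥-elim (x≢s (SameEdge⇒≡ on))
    shortcut {s} (step {f = f} s~f w) (inj₂ on) x≢s x≢t with x ≟E f
    shortcut (step _ (here _)) (inj₂ _) _ x≢t | yes refl = ⊥-elim (x≢t refl)
    shortcut {s} (step s~x (step {f = g} {k = k} x~g w)) (inj₂ _) _ _ | yes refl
      with near-at {s} {g} (neighbour-through-q s s~x) (neighbour-through-q g (LAdj-sym {x} {g} x~g))
    ... | inj₁ refl = k , s≤s (ℕP.n≤1+n k) , w
    ... | inj₂ s~g  = suc k , s≤s ℕP.≤-refl , step s~g w
    shortcut (step s~f w) (inj₂ on) _ x≢t | no x≢f with shortcut w on x≢f x≢t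
    ... | k′ , k′<k , w′ = suc k′ , s≤s k′<k , step s~f w′

    pendant-at-end : {s t : Edge K} → OnShortestPath x s t → (x ≡ s) ⊎ (x ≡ t)
    pendant-at-end {s} {t} (k , w , on , shortest) with x ≟E s | x ≟E t
    ... | yes x≡s | _       = inj₁ x≡s
    ... | no _    | yes x≡t = inj₂ x≡t
    ... | no x≢s  | no x≢t  with shortcut w on x≢s x≢t
    ...   | k′ , k′<k , w′ = ⊥-elim (ℕP.<⇒≱ k′<k (shortest k′ w′))

    pendant-in-geodetic : (S : EdgeSet K) → LineGeodetic K S → x ∈E S
    pendant-in-geodetic S geo with S (lo x) (hi x) in x∉S
    ... | true  = refl
    ... | false with geo x (λ x∈S → false≢true (trans (sym x∉S) x∈S))
    ...   | s , t , s∈S , t∈S , osp with pendant-at-end osp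
    ...     | inj₁ refl = ⊥-elim (false≢true (trans (sym x∉S) s∈S))
    ...     | inj₂ refl = ⊥-elim (false≢true (trans (sym x∉S) t∈S))

  middle-of-short-geodesic : {x s t : Edge K} → OnShortestPath x s t → x ≢ s → x ≢ t →
    WalkWithin s t 2 → LAdj s x × LAdj x t × ¬ Near s t
  middle-of-short-geodesic {x} {s} {t} (k , w , on , shortest) x≢s x≢t (k₀ , k₀≤2 , w₀) =
    shape w on (ℕP.≤-trans (shortest k₀ w₀) k₀≤2) shortest
    where
    shape : ∀ {k} (w : LWalk s t k) → OnWalk x w → k ≤ 2 → (∀ k′ → LWalk s t k′ → k ≤ k′) →
      LAdj s x × LAdj x t × ¬ Near s t
    shape (here _) on _ _ = ⊥-elim (x≢s (SameEdge⇒≡ on))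
    shape (step _ _) (inj₁ on) _ _ = ⊥-elim (x≢s (SameEdge⇒≡ on))
    shape (step _ (here _)) (inj₂ on) _ _ = ⊥-elim (x≢t (SameEdge⇒≡ on))
    shape (step _ (step _ (here _))) (inj₂ (inj₂ on)) _ _ = ⊥-elim (x≢t (SameEdge⇒≡ on))
    shape (step {f = f} s~f (step f~t (here _))) (inj₂ (inj₁ on)) _ shortest =
      subst (λ e → LAdj s e) (sym x≡f) s~f , subst (λ e → LAdj e t) (sym x≡f) f~t , not-near
      where
      x≡f : x ≡ f
      x≡f = SameEdge⇒≡ {x} {f} on
      not-near : ¬ Near s t
      not-near (inj₁ refl) with shortest 0 (here s)
      ... | ()
      not-near (inj₂ s~t) with shortest 1 (step s~t (here t))
      ... | s≤s ()
    shape (step _ (step _ (step _ _))) _ (s≤s (s≤s ())) _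

  -- Rerouting around a missing triangle.
  detour : {x g t : Edge K} {v y z : Fin (n K)} →
    Incident x v → Incident x y → v ≢ y → Incident g v → Incident g z → v ≢ z → g ≢ x →
    Incident t y → ¬ Incident t v → Adj K y z ≢ true → OnShortestPath x g t
  detour {x} {g} {t} {v} {y} {z} xv xy v≢y gv gz v≢z g≢x ty t∌v ¬yz =
    2 , step {f = x} g~x (step x~t (here t)) , inj₂ (inj₁ (refl , refl)) , at-least-two
    where
    y≢z : y ≢ z
    y≢z refl = g≢x (edge-by-endpoints {g} {x} gv gz xv xy v≢y)
    g~x : LAdj g x
    g~x = adjacent-at {g} {x} gv xv g≢x
    x~t : LAdj x t
    x~t = adjacent-at {x} {t} xy ty (λ { refl → t∌v xv })
    at-least-two : ∀ k → LWalk g t k → 2 ≤ k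
    at-least-two zero w with walk-zero w
    ... | refl = ⊥-elim (t∌v gv)
    at-least-two (suc zero) w with share⇒common {g} {t} (proj₂ (walk-one w))
    ... | r , gr , tr with only-two-endpoints {g} gv gz v≢z gr
    ...   | inj₁ refl = ⊥-elim (t∌v tr)
    ...   | inj₂ refl = ⊥-elim (¬yz (endpoints-adjacent {t} ty tr y≢z))
    at-least-two (suc (suc k)) _ = s≤s (s≤s z≤n)

  anyEdge? : {P : Edge K → Set} → (∀ e → Dec (P e)) → Dec (∃ P)
  anyEdge? {P} P? = map′ from to (FinP.any? λ x → FinP.any? λ y → at? x y)
    where
    At : Fin (n K) → Fin (n K) → Set
    At x y = Σ (toℕ x < toℕ y) λ x<y → Σ (Adj K x y ≡ true) λ a → P (edge x y x<y a)
    at? : ∀ x y → Dec (At x y)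
    at? x y with toℕ x ℕP.<? toℕ y | Adj K x y BoolP.≟ true
    ... | no x≮y  | _      = no λ (x<y , _) → x≮y x<y
    ... | yes _   | no ¬a  = no λ (_ , a , _) → ¬a a
    ... | yes x<y | yes a  = map′ (λ p → x<y , a , p)
      (λ (x<y′ , a′ , p) → subst P (edge-ext _ _ refl refl) p) (P? (edge x y x<y a))
    from : (∃ λ x → ∃ λ y → At x y) → ∃ P
    from (x , y , x<y , a , p) = edge x y x<y a , p
    to : ∃ P → ∃ λ x → ∃ λ y → At x y
    to (edge x y x<y a , p) = x , y , x<y , a , p

  allEdges? : {P : Edge K → Set} → (∀ e → Dec (P e)) → Dec (∀ e → P e)
  allEdges? {P} P? = map′
    (λ no-counterexample e → decidable-stable (P? e) (λ ¬p → no-counterexample (e , ¬p)))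
    (λ all (e , ¬p) → ¬p (all e))
    (¬? (anyEdge? (¬? ∘ P?)))

  LAdj? : (e f : Edge K) → Dec (LAdj e f)
  LAdj? e f = ¬? ((lo e FinP.≟ lo f) ×-dec (hi e FinP.≟ hi f)) ×-dec
    ((lo e FinP.≟ lo f) ⊎-dec (lo e FinP.≟ hi f) ⊎-dec (hi e FinP.≟ lo f) ⊎-dec (hi e FinP.≟ hi f))

  walk? : (k : ℕ) (s t : Edge K) → Dec (LWalk s t k)
  walk? zero s t = map′ (λ { refl → here s }) walk-zero (s ≟E t)
  walk? (suc k) s t = map′ (λ (f , s~f , w) → step s~f w) (λ { (step {f = f} s~f w) → f , s~f , w })
    (anyEdge? λ f → LAdj? s f ×-dec walk? k f t)

  walkThrough? : (k : ℕ) (s t x : Edge K) → Dec (Σ (LWalk s t k) (OnWalk x))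
  walkThrough? zero s t x with s ≟E t
  ... | no s≢t = no λ (w , _) → s≢t (walk-zero w)
  ... | yes refl = map′ (λ on → here s , on) (λ { (here _ , on) → on })
    ((lo x FinP.≟ lo s) ×-dec (hi x FinP.≟ hi s))
  walkThrough? (suc k) s t x = map′ from to (anyEdge? λ f → LAdj? s f ×-dec
      (((lo x FinP.≟ lo s) ×-dec (hi x FinP.≟ hi s)) ×-dec walk? k f t ⊎-dec walkThrough? k f t x))
    where
    Rest : Edge K → Set
    Rest f = LAdj s f × ((SameEdge x s × LWalk f t k) ⊎ Σ (LWalk f t k) (OnWalk x))
    from : ∃ Rest → Σ (LWalk s t (suc k)) (OnWalk x)
    from (f , s~f , inj₁ (on , w)) = step s~f w , inj₁ on
    from (f , s~f , inj₂ (w , on)) = step s~f w , inj₂ on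
    to : Σ (LWalk s t (suc k)) (OnWalk x) → ∃ Rest
    to (step {f = f} s~f w , inj₁ on) = f , s~f , inj₁ (on , w)
    to (step {f = f} s~f w , inj₂ on) = f , s~f , inj₂ (w , on)

  LineDiameter≤ : ℕ → Set
  LineDiameter≤ D = ∀ s t k → LWalk s t k → WalkWithin s t D

  -- With bounded diameter, lying on a shortest path is decidable: only the
  -- lengths k ≤ D need to be searched.
  onShortestPath? : (D : ℕ) → LineDiameter≤ D → (x s t : Edge K) → Dec (OnShortestPath x s t)
  onShortestPath? D diam x s t = map′ from to (ℕP.anyUpTo? P? (suc D))
    where
    P : ℕ → Set
    P k = Σ (LWalk s t k) (OnWalk x) × (∀ {i} → i < k → ¬ LWalk s t i)
    P? : ∀ k → Dec (P k)
    P? k = walkThrough? k s t x ×-dec ℕP.allUpTo? (λ i → ¬? (walk? i s t)) k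
    from : ∃ (λ k → k < suc D × P k) → OnShortestPath x s t
    from (k , _ , (w , on) , none-shorter) =
      k , w , on , λ k′ w′ → ℕP.≮⇒≥ (λ k′<k → none-shorter k′<k w′)
    to : OnShortestPath x s t → ∃ (λ k → k < suc D × P k)
    to (k , w , on , shortest) with diam s t k w
    ... | k₀ , k₀≤D , w₀ = k , s≤s (ℕP.≤-trans (shortest k₀ w₀) k₀≤D) , (w , on) ,
                           λ i<k wᵢ → ℕP.<⇒≱ i<k (shortest _ wᵢ)

  _∈?_ : (e : Edge K) (S : EdgeSet K) → Dec (e ∈E S)
  e ∈? S = S (lo e) (hi e) BoolP.≟ true

  lineGeodetic? : (D : ℕ) → LineDiameter≤ D → (S : EdgeSet K) → Dec (LineGeodetic K S)
  lineGeodetic? D diam S = allEdges? λ e → ¬? (e ∈? S) →-dec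
    anyEdge? λ s → anyEdge? λ t → (s ∈? S) ×-dec (t ∈? S) ×-dec onShortestPath? D diam e s t

  indicator : EdgeSet K → Fin (n K) → Fin (n K) → ℕ
  indicator S u v = if ⌊ toℕ u ℕP.<? toℕ v ⌋ ∧ Adj K u v ∧ S u v then 1 else 0

  card-as-sumFin : (S : EdgeSet K) → card K S ≡ sumFin (n K) λ u → sumFin (n K) λ v → indicator S u v
  card-as-sumFin S = trans (cong sum (ListP.map-cong (λ u → sum-allFin (n K) (indicator S u)) (allFin (n K))))
                           (sum-allFin (n K) λ u → sumFin (n K) (indicator S u))

  card-cong : (S T : EdgeSet K) → (∀ u v → S u v ≡ T u v) → card K S ≡ card K T
  card-cong S T S≡T = begin
    card K S                                                       ≡⟨ card-as-sumFin S ⟩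
    sumFin (n K) (λ u → sumFin (n K) λ v → indicator S u v)        ≡⟨ sumFin-cong (n K) (λ u →
                                                                        sumFin-cong (n K) λ v → cong (indicator′ u v) (S≡T u v)) ⟩
    sumFin (n K) (λ u → sumFin (n K) λ v → indicator T u v)        ≡⟨ card-as-sumFin T ⟨
    card K T                                                       ∎
    where
    open ≡-Reasoning
    indicator′ : Fin (n K) → Fin (n K) → Bool → ℕ
    indicator′ u v b = if ⌊ toℕ u ℕP.<? toℕ v ⌋ ∧ Adj K u v ∧ b then 1 else 0

  card-point : (S T : EdgeSet K) (x y : Fin (n K)) {a b : ℕ} →
    (∀ u v → (u ≡ x × v ≡ y → ⊥) → S u v ≡ T u v) →
    a + indicator S x y ≤ b + indicator T x y → a + card K S ≤ b + card K T
  card-point S T x y {a} {b} agree at-xy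
    rewrite card-as-sumFin S | card-as-sumFin T =
    sumFin-point (n K) x
      (λ u u≢x → ℕP.≤-reflexive (sumFin-cong (n K) λ v → cong-indicator u v (agree u v λ (u≡x , _) → u≢x u≡x)))
      (sumFin-point (n K) y
        (λ v v≢y → ℕP.≤-reflexive (cong-indicator x v (agree x v λ (_ , v≡y) → v≢y v≡y)))
        at-xy)
    where
    cong-indicator : ∀ u v → S u v ≡ T u v → indicator S u v ≡ indicator T u v
    cong-indicator u v S≡T rewrite S≡T = refl

  update : EdgeSet K → Fin (n K) → Fin (n K) → Bool → EdgeSet K
  update S x y b u v with u FinP.≟ x | v FinP.≟ y
  ... | yes _ | yes _ = b
  ... | _     | _     = S u v

  update-here : ∀ S x y b → update S x y b x y ≡ b
  update-here S x y b with x FinP.≟ x | y FinP.≟ y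
  ... | yes _ | yes _  = refl
  ... | no x≢x | _     = ⊥-elim (x≢x refl)
  ... | yes _ | no y≢y = ⊥-elim (y≢y refl)

  update-elsewhere : ∀ S x y b u v → (u ≡ x × v ≡ y → ⊥) → update S x y b u v ≡ S u v
  update-elsewhere S x y b u v elsewhere with u FinP.≟ x | v FinP.≟ y
  ... | yes u≡x | yes v≡y = ⊥-elim (elsewhere (u≡x , v≡y))
  ... | yes _   | no _    = refl
  ... | no _    | yes _   = refl
  ... | no _    | no _    = refl

  update-preserves : ∀ S x y b u v → S u v ≡ b → update S x y b u v ≡ b
  update-preserves S x y b u v S≡b with u FinP.≟ x | v FinP.≟ y
  ... | yes _    | yes _    = refl
  ... | yes _    | no _     = S≡b
  ... | no _     | yes _    = S≡b
  ... | no _     | no _     = S≡b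

  card-remove : ∀ S x y → toℕ x < toℕ y → Adj K x y ≡ true → S x y ≡ true →
    suc (card K (update S x y false)) ≤ card K S
  card-remove S x y x<y a x∈S = card-point (update S x y false) S x y
    (update-elsewhere S x y false) (ℕP.≤-reflexive (trans (cong suc removed) (sym present)))
    where
    removed : indicator (update S x y false) x y ≡ 0
    removed rewrite update-here S x y false | BoolP.∧-zeroʳ (Adj K x y)
                  | BoolP.∧-zeroʳ ⌊ toℕ x ℕP.<? toℕ y ⌋ = refl
    present : indicator S x y ≡ 1
    present with toℕ x ℕP.<? toℕ y
    ... | no x≮y = ⊥-elim (x≮y x<y)
    ... | yes _ rewrite a | x∈S = refl

  card-insert : ∀ S x y b → card K (update S x y b) ≤ suc (card K S)
  card-insert S x y b = card-point (update S x y b) S x y (update-elsewhere S x y b)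
    (ℕP.≤-trans (indicator≤1 (update S x y b) x y) (s≤s z≤n))
    where
    indicator≤1 : ∀ T u v → indicator T u v ≤ 1
    indicator≤1 T u v with ⌊ toℕ u ℕP.<? toℕ v ⌋ ∧ Adj K u v ∧ T u v
    ... | true  = ℕP.≤-refl
    ... | false = z≤n

  lineGeodetic-cong : (S T : EdgeSet K) → (∀ u v → S u v ≡ T u v) → LineGeodetic K S → LineGeodetic K T
  lineGeodetic-cong S T S≡T geo e e∉T with geo e (λ e∈S → e∉T (trans (sym (S≡T (lo e) (hi e))) e∈S))
  ... | s , t , s∈S , t∈S , osp =
    s , t , trans (sym (S≡T (lo s) (hi s))) s∈S , trans (sym (S≡T (lo t) (hi t))) t∈S , osp

  -- Every edge set is represented, pointwise, by a subset of the n·n vertex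
  -- pairs; this makes existential statements over edge sets decidable.
  fromSubset : Subset (n K * n K) → EdgeSet K
  fromSubset s u v = lookup s (combine u v)

  toSubset : EdgeSet K → Subset (n K * n K)
  toSubset S = tabulate (uncurry S ∘ remQuot (n K))

  fromSubset-toSubset : ∀ S u v → fromSubset (toSubset S) u v ≡ S u v
  fromSubset-toSubset S u v =
    trans (lookup∘tabulate (uncurry S ∘ remQuot (n K)) (combine u v))
          (cong (uncurry S) (FinP.remQuot-combine u v))

  -- Starting from a line geodetic S with card S ≤ b, either some line
  -- geodetic set has size < b (and we descend), or S is already minimum.
  minimum-exists : (∀ S → Dec (LineGeodetic K S)) → Σ (EdgeSet K) (MinLineGeodetic K)
  minimum-exists geo? = descend (card K all) all (λ e e∉all → ⊥-elim (e∉all refl)) ℕP.≤-refl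
    where
    all : EdgeSet K
    all _ _ = true
    descend : ∀ b S → LineGeodetic K S → card K S ≤ b → Σ (EdgeSet K) (MinLineGeodetic K)
    descend zero S geo card≤0 = S , geo , λ _ _ → ℕP.≤-trans card≤0 z≤n
    descend (suc b) S geo card≤1+b
      with anySubset? (λ s → geo? (fromSubset s) ×-dec (card K (fromSubset s) ℕP.≤? b))
    ... | yes (s , geo′ , card≤b) = descend b (fromSubset s) geo′ card≤b
    ... | no none = S , geo , minimum
      where
      minimum : ∀ S′ → LineGeodetic K S′ → card K S ≤ card K S′
      minimum S′ geo′ = ℕP.≤-trans card≤1+b (ℕP.≰⇒> λ card′≤b → none
        ( toSubset S′
        , lineGeodetic-cong S′ _ (λ u v → sym (fromSubset-toSubset S′ u v)) geo′
        , subst (_≤ b) (card-cong S′ _ (λ u v → sym (fromSubset-toSubset S′ u v))) card′≤b))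

module Construction (G : Graph) where

  m : ℕ
  m = n G

  HG : Graph
  HG = H G

  Vertex : Set
  Vertex = Fin (m + 4)

  old : Fin m → Vertex
  old u = u ↑ˡ 4

  new : Fin 4 → Vertex
  new j = m ↑ʳ j

  va vb vc vd : Vertex
  va = new 0F
  vb = new 1F
  vc = new 2F
  vd = new 3F

  adj-old-old : ∀ u w → Adj HG (old u) (old w) ≡ Adj G u w
  adj-old-old u w rewrite FinP.splitAt-↑ˡ m u 4 | FinP.splitAt-↑ˡ m w 4 = refl

  adj-old-new : ∀ u j → Adj HG (old u) (new j) ≡ isBC j
  adj-old-new u j rewrite FinP.splitAt-↑ˡ m u 4 | FinP.splitAt-↑ʳ m 4 j = refl

  adj-new-new : ∀ i j → Adj HG (new i) (new j) ≡ newAdj i j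
  adj-new-new i j rewrite FinP.splitAt-↑ʳ m 4 i | FinP.splitAt-↑ʳ m 4 j = refl

  old<new : ∀ u j → toℕ (old u) < toℕ (new j)
  old<new u j rewrite FinP.toℕ-↑ˡ u 4 | FinP.toℕ-↑ʳ m j = ℕP.<-≤-trans (FinP.toℕ<n u) (ℕP.m≤m+n m (toℕ j))

  old≢new : ∀ {u j} → old u ≢ new j
  old≢new {u} {j} eq = ℕP.<⇒≢ (old<new u j) (cong toℕ eq)

  old-injective : ∀ {u w} → old u ≡ old w → u ≡ w
  old-injective {u} {w} = FinP.↑ˡ-injective 4 u w

  new-injective : ∀ {i j} → new i ≡ new j → i ≡ j
  new-injective {i} {j} = FinP.↑ʳ-injective m i j

  old-mono : ∀ {u w} → toℕ u < toℕ w → toℕ (old u) < toℕ (old w)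
  old-mono {u} {w} = subst₂ _<_ (sym (FinP.toℕ-↑ˡ u 4)) (sym (FinP.toℕ-↑ˡ w 4))

  old-order : ∀ {u w} → toℕ (old u) < toℕ (old w) → toℕ u < toℕ w
  old-order {u} {w} = subst₂ _<_ (FinP.toℕ-↑ˡ u 4) (FinP.toℕ-↑ˡ w 4)

  new-mono : ∀ {i j} → toℕ i < toℕ j → toℕ (new i) < toℕ (new j)
  new-mono {i} {j} i<j rewrite FinP.toℕ-↑ʳ m i | FinP.toℕ-↑ʳ m j = ℕP.+-monoʳ-< m i<j

  new-order : ∀ {i j} → toℕ (new i) < toℕ (new j) → toℕ i < toℕ j
  new-order {i} {j} lt rewrite FinP.toℕ-↑ʳ m i | FinP.toℕ-↑ʳ m j = ℕP.+-cancelˡ-< m (toℕ i) (toℕ j) lt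

  data Side : Set where
    B C : Side

  side : Side → Fin 4
  side B = 1F
  side C = 2F

  side-joined : ∀ β → isBC (side β) ≡ true
  side-joined B = refl
  side-joined C = refl

  abE cdE : Edge HG
  abE = edge va vb (new-mono (s≤s z≤n)) (adj-new-new 0F 1F)
  cdE = edge vc vd (new-mono (s≤s (s≤s (s≤s z≤n)))) (adj-new-new 2F 3F)

  spoke : Fin m → Side → Edge HG
  spoke v β = edge (old v) (new (side β)) (old<new v (side β)) (trans (adj-old-new v (side β)) (side-joined β))

  lift : Edge G → Edge HG
  lift e = edge (old (lo e)) (old (hi e)) (old-mono (lo<hi e)) (trans (adj-old-old (lo e) (hi e)) (adj e))

  data VertexView : Vertex → Set where
    old-vertex : (u : Fin m) → VertexView (old u)
    new-vertex : (j : Fin 4) → VertexView (new j)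

  vertexView : ∀ x → VertexView x
  vertexView x with splitAt m x in eq
  ... | inj₁ u = subst VertexView (FinP.splitAt⁻¹-↑ˡ eq) (old-vertex u)
  ... | inj₂ j = subst VertexView (FinP.splitAt⁻¹-↑ʳ eq) (new-vertex j)

  data EdgeView : Edge HG → Set where
    ab-edge    : EdgeView abE
    cd-edge    : EdgeView cdE
    spoke-edge : ∀ v β → EdgeView (spoke v β)
    old-edge   : ∀ e → EdgeView (lift e)

  private
    same-ends : ∀ {l h p p′ q q′} → EdgeView (edge l h p q) → EdgeView (edge l h p′ q′)
    same-ends {l} {h} = subst EdgeView (edge-ext (edge l h _ _) (edge l h _ _) refl refl)

    joined-side : ∀ j → isBC j ≡ true → Σ Side λ β → side β ≡ j
    joined-side 1F _ = B , refl
    joined-side 2F _ = C , refl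
    joined-side 0F ()
    joined-side 3F ()

    new-edge : ∀ i j → newAdj i j ≡ true → toℕ i < toℕ j → (i ≡ 0F × j ≡ 1F) ⊎ (i ≡ 2F × j ≡ 3F)
    new-edge 0F 1F _ _ = inj₁ (refl , refl)
    new-edge 2F 3F _ _ = inj₂ (refl , refl)
    new-edge 1F 0F _ ()
    new-edge 3F 2F _ (s≤s (s≤s ()))
    new-edge 0F 0F () _
    new-edge 0F 2F () _
    new-edge 0F 3F () _
    new-edge 1F 1F () _
    new-edge 1F 2F () _
    new-edge 1F 3F () _
    new-edge 2F 0F () _
    new-edge 2F 1F () _
    new-edge 2F 2F () _
    new-edge 3F 0F () _
    new-edge 3F 1F () _
    new-edge 3F 3F () _

  edgeView : ∀ e → EdgeView e
  edgeView (edge l h l<h a) with vertexView l | vertexView h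
  ... | old-vertex u | old-vertex w =
    same-ends (old-edge (edge u w (old-order l<h) (trans (sym (adj-old-old u w)) a)))
  ... | old-vertex u | new-vertex j with joined-side j (trans (sym (adj-old-new u j)) a)
  ...   | β , refl = same-ends (spoke-edge u β)
  edgeView (edge l h l<h a) | new-vertex i | old-vertex w = ⊥-elim (ℕP.<-asym l<h (old<new w i))
  edgeView (edge l h l<h a) | new-vertex i | new-vertex j
    with new-edge i j (trans (sym (adj-new-new i j)) a) (new-order l<h)
  ... | inj₁ (refl , refl) = same-ends ab-edge
  ... | inj₂ (refl , refl) = same-ends cd-edge

  new≢new : ∀ {i j} → i ≢ j → new i ≢ new j
  new≢new i≢j = i≢j ∘ new-injective

  lift-at-new : ∀ {e j} → ¬ Incident (lift e) (new j)
  lift-at-new (inj₁ eq) = old≢new eq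
  lift-at-new (inj₂ eq) = old≢new eq

  spoke-at-new : ∀ {v β j} → Incident (spoke v β) (new j) → side β ≡ j
  spoke-at-new (inj₁ eq) = ⊥-elim (old≢new eq)
  spoke-at-new (inj₂ eq) = new-injective eq

  only-ab-at-a : ∀ f → Incident f va → f ≡ abE
  only-ab-at-a f f∋a with edgeView f
  ... | ab-edge = refl
  ... | cd-edge = ⊥-elim ([ new≢new (λ ()) , new≢new (λ ()) ]′ f∋a)
  ... | spoke-edge v B with () ← spoke-at-new {v} {B} f∋a
  ... | spoke-edge v C with () ← spoke-at-new {v} {C} f∋a
  ... | old-edge e = ⊥-elim (lift-at-new {e} f∋a)

  only-cd-at-d : ∀ f → Incident f vd → f ≡ cdE
  only-cd-at-d f f∋d with edgeView f
  ... | cd-edge = refl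
  ... | ab-edge = ⊥-elim ([ new≢new (λ ()) , new≢new (λ ()) ]′ f∋d)
  ... | spoke-edge v B with () ← spoke-at-new {v} {B} f∋d
  ... | spoke-edge v C with () ← spoke-at-new {v} {C} f∋d
  ... | old-edge e = ⊥-elim (lift-at-new {e} f∋d)

  edges-at-b : ∀ f → Incident f vb → (f ≡ abE) ⊎ Σ (Fin m) λ v → f ≡ spoke v B
  edges-at-b f f∋b with edgeView f
  ... | ab-edge = inj₁ refl
  ... | cd-edge = ⊥-elim ([ new≢new (λ ()) , new≢new (λ ()) ]′ f∋b)
  ... | spoke-edge v B = inj₂ (v , refl)
  ... | spoke-edge v C with () ← spoke-at-new {v} {C} f∋b
  ... | old-edge e = ⊥-elim (lift-at-new {e} f∋b)

  module PendantAB = Pendant {HG} abE va vb (inj₁ refl) (inj₂ refl) (new≢new (λ ())) only-ab-at-a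
  module PendantCD = Pendant {HG} cdE vd vc (inj₂ refl) (inj₁ refl) (new≢new (λ ())) only-cd-at-d

  ab~spokeB : ∀ v → LAdj abE (spoke v B)
  ab~spokeB v = adjacent-at {HG} {abE} {spoke v B} (inj₂ refl) (inj₂ refl) (λ eq → old≢new (sym (cong lo eq)))

  spokeB~spokeC : ∀ v → LAdj (spoke v B) (spoke v C)
  spokeB~spokeC v = adjacent-at {HG} {spoke v B} {spoke v C} (inj₁ refl) (inj₁ refl) (λ eq → new≢new (λ ()) (cong hi eq))

  spokeC~cd : ∀ v → LAdj (spoke v C) cdE
  spokeC~cd v = adjacent-at {HG} {spoke v C} {cdE} (inj₂ refl) (inj₁ refl) (λ eq → old≢new (cong lo eq))

  ab-to-cd : Fin m → LWalk abE cdE 3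
  ab-to-cd v = step {f = spoke v B} (ab~spokeB v) (step {f = spoke v C} (spokeB~spokeC v) (step (spokeC~cd v) (here cdE)))

  -- ab and cd are at distance 3: a shorter walk would need an edge through
  -- both b and c, but b and c are not adjacent.
  ab-cd-far : ∀ k → LWalk abE cdE k → 3 ≤ k
  ab-cd-far zero w = ⊥-elim (new≢new (λ ()) (cong lo (walk-zero w)))
  ab-cd-far (suc zero) w =
    ⊥-elim ([ new≢new (λ ()) , new≢new (λ ()) ]′ (PendantAB.neighbour-through-q cdE (LAdj-sym {HG} {abE} {cdE} (walk-one w))))
  ab-cd-far (suc (suc zero)) (step {f = f} ab~f (step f~cd (here _))) =
    ⊥-elim (false≢true (trans (sym (adj-new-new 1F 2F)) b~c))
    where
    b~c : Adj HG vb vc ≡ true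
    b~c = endpoints-adjacent {HG} {f} (PendantAB.neighbour-through-q f (LAdj-sym {HG} {abE} {f} ab~f))
                                      (PendantCD.neighbour-through-q f f~cd) (new≢new (λ ()))
  ab-cd-far (suc (suc (suc k))) _ = s≤s (s≤s (s≤s z≤n))

  spoke-on-geodesic : ∀ v β → OnShortestPath (spoke v β) abE cdE
  spoke-on-geodesic v β = 3 , ab-to-cd v , position β , ab-cd-far
    where
    position : ∀ β → OnWalk (spoke v β) (ab-to-cd v)
    position B = inj₂ (inj₁ (refl , refl))
    position C = inj₂ (inj₂ (inj₁ (refl , refl)))

  near-b : ∀ e → e ≢ cdE → Σ (Edge HG) λ f → Incident f vb × Near e f
  near-b e e≢cd with edgeView e
  ... | ab-edge = abE , inj₂ refl , inj₁ refl
  ... | cd-edge = ⊥-elim (e≢cd refl)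
  ... | spoke-edge v B = spoke v B , inj₂ refl , inj₁ refl
  ... | spoke-edge v C = spoke v B , inj₂ refl , inj₂ (LAdj-sym {HG} {spoke v B} {spoke v C} (spokeB~spokeC v))
  ... | old-edge x = spoke (lo x) B , inj₂ refl , near-at {HG} {lift x} {spoke (lo x) B} (inj₁ refl) (inj₁ refl)

  near-c : ∀ e → e ≢ abE → Σ (Edge HG) λ f → Incident f vc × Near e f
  near-c e e≢ab with edgeView e
  ... | ab-edge = ⊥-elim (e≢ab refl)
  ... | cd-edge = cdE , inj₁ refl , inj₁ refl
  ... | spoke-edge v B = spoke v C , inj₂ refl , inj₂ (spokeB~spokeC v)
  ... | spoke-edge v C = spoke v C , inj₂ refl , inj₁ refl
  ... | old-edge x = spoke (lo x) C , inj₂ refl , near-at {HG} {lift x} {spoke (lo x) C} (inj₁ refl) (inj₁ refl)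

  via-b : ∀ {s t} → s ≢ cdE → t ≢ cdE → WalkWithin s t 3
  via-b {s} {t} s≢cd t≢cd with near-b s s≢cd | near-b t t≢cd
  ... | e , e∋b , s≈e | f , f∋b , t≈f = pass-through {HG} {s} {e} {f} {t} s≈e e∋b f∋b (Near-sym {HG} {t} {f} t≈f)

  via-c : ∀ {s t} → s ≢ abE → t ≢ abE → WalkWithin s t 3
  via-c {s} {t} s≢ab t≢ab with near-c s s≢ab | near-c t t≢ab
  ... | e , e∋c , s≈e | f , f∋c , t≈f = pass-through {HG} {s} {e} {f} {t} s≈e e∋c f∋c (Near-sym {HG} {t} {f} t≈f)

  cd≢ab : cdE ≢ abE
  cd≢ab eq = new≢new (λ ()) (cong lo eq)

  -- A walk from ab to cd must continue along some spoke bv, so ab-to-cd v exists.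
  ab-cd-within : ∀ {k} → LWalk abE cdE k → WalkWithin abE cdE 3
  ab-cd-within {zero} w = ⊥-elim (cd≢ab (sym (walk-zero w)))
  ab-cd-within {suc _} (step {f = f} ab~f _) with edges-at-b f (PendantAB.neighbour-through-q f (LAdj-sym {HG} {abE} {f} ab~f))
  ... | inj₁ refl    = ⊥-elim (proj₁ ab~f (refl , refl))
  ... | inj₂ (v , _) = 3 , ℕP.≤-refl , ab-to-cd v

  diameter : LineDiameter≤ {HG} 3
  diameter s t k w with s ≟E cdE | t ≟E cdE | s ≟E abE | t ≟E abE
  ... | no s≢cd  | no t≢cd  | _        | _        = via-b s≢cd t≢cd
  ... | _        | _        | no s≢ab  | no t≢ab  = via-c s≢ab t≢ab
  ... | _        | yes refl | yes refl | _        = ab-cd-within w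
  ... | yes refl | _        | _        | yes refl with ab-cd-within (reverse w)
  ...   | k′ , k′≤3 , w′ = k′ , k′≤3 , reverse w′
  diameter s t k w | yes refl | _ | yes cd≡ab | _ = ⊥-elim (cd≢ab cd≡ab)
  diameter s t k w | _ | yes refl | _ | yes cd≡ab = ⊥-elim (cd≢ab cd≡ab)

  spoke-eccentricity : ∀ v β t → WalkWithin (spoke v β) t 2
  spoke-eccentricity v B t with t ≟E cdE
  ... | yes refl = prepend-near {HG} {spoke v B} {spoke v C} (inj₂ (spokeB~spokeC v)) (near-walk {HG} {spoke v C} (inj₂ (spokeC~cd v)))
  ... | no t≢cd with near-b t t≢cd
  ...   | f , f∋b , t≈f = meet-at {HG} {spoke v B} {f} (inj₂ refl) f∋b (Near-sym {HG} {t} {f} t≈f)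
  spoke-eccentricity v C t with t ≟E abE
  ... | yes refl = prepend-near {HG} {spoke v C} {spoke v B} (inj₂ (LAdj-sym {HG} {spoke v B} {spoke v C} (spokeB~spokeC v)))
                     (near-walk {HG} {spoke v B} (inj₂ (LAdj-sym {HG} {abE} {spoke v B} (ab~spokeB v))))
  ... | no t≢ab with near-c t t≢ab
  ...   | f , f∋c , t≈f = meet-at {HG} {spoke v C} {f} (inj₂ refl) f∋c (Near-sym {HG} {t} {f} t≈f)

module Exchange (G : Graph) (triangle-free : TriangleFree G) where
  open Construction G public

  lift≢spoke : ∀ {x v β} → lift x ≢ spoke v β
  lift≢spoke eq = old≢new (cong hi eq)

  spoke-meets-lift : ∀ {v β x} → LAdj (spoke v β) (lift x) → Incident (lift x) (old v)
  spoke-meets-lift {v} {β} {x} (_ , share) with share⇒common {HG} {spoke v β} {lift x} share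
  ... | _ , inj₁ refl , x∋v   = x∋v
  ... | _ , inj₂ refl , x∋new = ⊥-elim (lift-at-new {x} x∋new)

  other-end : ∀ {x v} → Incident (lift x) (old v) → Σ (Fin m) λ y → Incident (lift x) (old y) × v ≢ y
  other-end {x} (inj₁ l≡v) = hi x , inj₂ refl , λ { refl → ℕP.<⇒≢ (lo<hi x) (cong toℕ (old-injective l≡v)) }
  other-end {x} (inj₂ h≡v) = lo x , inj₁ refl , λ { refl → ℕP.<⇒≢ (lo<hi x) (cong toℕ (sym (old-injective h≡v))) }

  lift-ends-adjacent : ∀ {x v y} → Incident (lift x) (old v) → Incident (lift x) (old y) → v ≢ y → Adj G v y ≡ true
  lift-ends-adjacent {x} {v} {y} x∋v x∋y v≢y =
    trans (sym (adj-old-old v y)) (endpoints-adjacent {HG} {lift x} x∋v x∋y (v≢y ∘ old-injective))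

  through-spoke : ∀ v β x t → OnShortestPath (lift x) (spoke v β) t → lift x ≢ t →
    Σ (Fin m) λ y → Incident (lift x) (old v) × Incident (lift x) (old y) × v ≢ y ×
                    Incident t (old y) × ¬ Incident t (old v)
  through-spoke v β x t osp x≢t = y , x∋v , x∋y , v≢y , t∋y , t∌v
    where
    shape : LAdj (spoke v β) (lift x) × LAdj (lift x) t × ¬ Near (spoke v β) t
    shape = middle-of-short-geodesic {HG} {lift x} {spoke v β} {t} osp lift≢spoke x≢t (spoke-eccentricity v β t)
    x∋v : Incident (lift x) (old v)
    x∋v = spoke-meets-lift {v} {β} {x} (proj₁ shape)
    y : Fin m
    y = proj₁ (other-end {x} x∋v)
    x∋y : Incident (lift x) (old y)
    x∋y = proj₁ (proj₂ (other-end {x} x∋v))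
    v≢y : v ≢ y
    v≢y = proj₂ (proj₂ (other-end {x} x∋v))
    t∌v : ¬ Incident t (old v)
    t∌v t∋v = proj₂ (proj₂ shape) (near-at {HG} {spoke v β} {t} (inj₁ refl) t∋v)
    t∋y : Incident t (old y)
    t∋y with share⇒common {HG} {lift x} {t} (proj₂ (proj₁ (proj₂ shape)))
    ... | r , x∋r , t∋r with only-two-endpoints {HG} {lift x} x∋v x∋y (v≢y ∘ old-injective) x∋r
    ...   | inj₁ refl = ⊥-elim (t∌v t∋r)
    ...   | inj₂ refl = t∋r

  EdgeOfGAt : EdgeSet HG → Fin m → Set
  EdgeOfGAt Q′ v = Σ (Edge HG) λ g → g ∈E Q′ × Σ (Fin m) λ z →
    Incident g (old v) × Incident g (old z) × Adj G v z ≡ true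

  -- Spokes, ab and cd are covered by ab and cd; a lifted
  -- edge x = vy covered through e is covered through vz instead: the path
  -- vz, vy, t is shortest as G has no triangle vyz.
  module Exchanged (Q Q′ : EdgeSet HG) (geo : LineGeodetic HG Q) (v : Fin m) (β : Side)
    (keep : ∀ f → f ∈E Q → f ≢ spoke v β → f ∈E Q′)
    (cover : ∃ (λ y → Adj G v y ≡ true) → EdgeOfGAt Q′ v) where

    -- ab and cd are pendant, hence in Q, hence in Q′.
    ab∈Q′ : abE ∈E Q′
    ab∈Q′ = keep abE (PendantAB.pendant-in-geodetic Q geo) (λ eq → old≢new (sym (cong lo eq)))

    cd∈Q′ : cdE ∈E Q′
    cd∈Q′ = keep cdE (PendantCD.pendant-in-geodetic Q geo) (λ eq → old≢new (sym (cong lo eq)))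

    Covered : Edge HG → Set
    Covered x = ∃[ s ] ∃[ t ] (s ∈E Q′ × t ∈E Q′ × OnShortestPath x s t)

    -- The case where x lies on a geodesic from e to t ∈ Q: use g = vz instead of e.
    reroute : ∀ x t → ¬ lift x ∈E Q′ → t ∈E Q → OnShortestPath (lift x) (spoke v β) t → Covered (lift x)
    reroute x t x∉Q′ t∈Q osp
      with through-spoke v β x t osp (λ { refl → x∉Q′ (keep t t∈Q lift≢spoke) })
    ... | y , x∋v , x∋y , v≢y , t∋y , t∌v
      with cover (y , lift-ends-adjacent {x} x∋v x∋y v≢y)
    ...   | g , g∈Q′ , z , g∋v , g∋z , v~z =
      g , t , g∈Q′ , keep t t∈Q (λ { refl → t∌v (inj₁ refl) }) ,
      detour {HG} {lift x} {g} {t} x∋v x∋y (v≢y ∘ old-injective) g∋v g∋z (v≢z ∘ old-injective)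
             (λ { refl → x∉Q′ g∈Q′ }) t∋y t∌v no-triangle
      where
      v≢z : v ≢ z
      v≢z refl = false≢true (trans (sym (irrefl G v)) v~z)
      no-triangle : Adj HG (old y) (old z) ≢ true
      no-triangle y~z = triangle-free (v , y , z , lift-ends-adjacent {x} x∋v x∋y v≢y , trans (sym (adj-old-old y z)) y~z , v~z)

    covered-lift : ∀ x → ¬ lift x ∈E Q′ → Covered (lift x)
    covered-lift x x∉Q′ with geo (lift x) (λ x∈Q → x∉Q′ (keep (lift x) x∈Q lift≢spoke))
    ... | s , t , s∈Q , t∈Q , osp with s ≟E spoke v β | t ≟E spoke v β
    ...   | no s≢e   | no t≢e   = s , t , keep s s∈Q s≢e , keep t t∈Q t≢e , osp
    ...   | yes refl | _        = reroute x t x∉Q′ t∈Q osp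
    ...   | no _     | yes refl = reroute x s x∉Q′ s∈Q (OnShortestPath-sym {HG} {lift x} {s} {t} osp)

    geodetic : LineGeodetic HG Q′
    geodetic x x∉Q′ with edgeView x
    ... | ab-edge        = ⊥-elim (x∉Q′ ab∈Q′)
    ... | cd-edge        = ⊥-elim (x∉Q′ cd∈Q′)
    ... | spoke-edge w γ = abE , cdE , ab∈Q′ , cd∈Q′ , spoke-on-geodesic w γ
    ... | old-edge x     = covered-lift x x∉Q′

  Cleared : EdgeSet HG → Fin m → Side → Set
  Cleared Q u γ = Q (old u) (new (side γ)) ≡ false

  Better : EdgeSet HG → EdgeSet HG → Set
  Better Q Q′ = LineGeodetic HG Q′ × card HG Q′ ≤ card HG Q × (∀ u γ → Cleared Q u γ → Cleared Q′ u γ)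

  Better-trans : ∀ {Q₁ Q₂ Q₃} → Better Q₁ Q₂ → Better Q₂ Q₃ → Better Q₁ Q₃
  Better-trans (_ , c₁₂ , k₁₂) (geo₃ , c₂₃ , k₂₃) = geo₃ , ℕP.≤-trans c₂₃ c₁₂ , λ u γ → k₂₃ u γ ∘ k₁₂ u γ

  module Removal (Q : EdgeSet HG) (geo : LineGeodetic HG Q) (v : Fin m) (β : Side)
                 (e∈Q : Q (old v) (new (side β)) ≡ true) where

    e : Edge HG
    e = spoke v β

    Q₁ : EdgeSet HG
    Q₁ = update {HG} Q (old v) (new (side β)) false

    keep₁ : ∀ f → f ∈E Q → f ≢ e → f ∈E Q₁
    keep₁ f f∈Q f≢e = trans (update-elsewhere {HG} Q (old v) (new (side β)) false (lo f) (hi f)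
                              (λ (l≡ , h≡) → f≢e (edge-ext f e l≡ h≡))) f∈Q

    removal : suc (card HG Q₁) ≤ card HG Q
    removal = card-remove {HG} Q (old v) (new (side β)) (lo<hi e) (adj e) e∈Q

    cleared₁ : Cleared Q₁ v β
    cleared₁ = update-here {HG} Q (old v) (new (side β)) false

    shrinks₁ : ∀ u γ → Cleared Q u γ → Cleared Q₁ u γ
    shrinks₁ u γ = update-preserves {HG} Q (old v) (new (side β)) false (old u) (new (side γ))

    isolated : ¬ ∃ (λ z → Adj G v z ≡ true) → Σ (EdgeSet HG) λ Q′ → Better Q Q′ × Cleared Q′ v β
    isolated no-neighbour =
      Q₁ , (Exchanged.geodetic Q Q₁ geo v β keep₁ (⊥-elim ∘ no-neighbour) , ℕP.≤-trans (ℕP.n≤1+n _) removal , shrinks₁) ,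
      cleared₁

    with-neighbour : ∀ z → Adj G v z ≡ true → Σ (EdgeSet HG) λ Q′ → Better Q Q′ × Cleared Q′ v β
    with-neighbour z v~z = Q₂ , (Exchanged.geodetic Q Q₂ geo v β keep₂ (λ _ → g , g∈Q₂ , z , g∋v , g∋z , v~z) ,
      ℕP.≤-trans (card-insert {HG} Q₁ (lo g) (hi g) true) removal , λ u γ → spoke-kept u γ ∘ shrinks₁ u γ) ,
      spoke-kept v β cleared₁
      where
      g : Edge HG
      g = proj₁ (edge-between {HG} (old v) (old z) (trans (adj-old-old v z) v~z))
      g∋v : Incident g (old v)
      g∋v = proj₁ (proj₂ (edge-between {HG} (old v) (old z) (trans (adj-old-old v z) v~z)))
      g∋z : Incident g (old z)
      g∋z = proj₂ (proj₂ (edge-between {HG} (old v) (old z) (trans (adj-old-old v z) v~z)))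
      Q₂ : EdgeSet HG
      Q₂ = update {HG} Q₁ (lo g) (hi g) true
      g∈Q₂ : g ∈E Q₂
      g∈Q₂ = update-here {HG} Q₁ (lo g) (hi g) true
      keep₂ : ∀ f → f ∈E Q → f ≢ e → f ∈E Q₂
      keep₂ f f∈Q f≢e = update-preserves {HG} Q₁ (lo g) (hi g) true (lo f) (hi f) (keep₁ f f∈Q f≢e)
      -- g is not a spoke, so adding it leaves the spokes untouched.
      hi-old : ∀ j → hi g ≢ new j
      hi-old j hi≡new with only-two-endpoints {HG} {g} g∋v g∋z (λ v≡z → false≢true
                             (trans (sym (irrefl HG (old v))) (trans (cong (Adj HG (old v)) v≡z) (trans (adj-old-old v z) v~z))))
                             (inj₂ refl)
      ... | inj₁ hi≡v = old≢new (trans (sym hi≡v) hi≡new)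
      ... | inj₂ hi≡z = old≢new (trans (sym hi≡z) hi≡new)
      spoke-kept : ∀ u γ → Cleared Q₁ u γ → Cleared Q₂ u γ
      spoke-kept u γ cleared = trans (update-elsewhere {HG} Q₁ (lo g) (hi g) true (old u) (new (side γ))
                                       (λ (_ , new≡hi) → hi-old (side γ) (sym new≡hi))) cleared

    result : Σ (EdgeSet HG) λ Q′ → Better Q Q′ × Cleared Q′ v β
    result with FinP.any? (λ z → Adj G v z BoolP.≟ true)
    ... | yes (z , v~z) = with-neighbour z v~z
    ... | no no-neighbour = isolated no-neighbour

  clear-spoke : ∀ Q → LineGeodetic HG Q → ∀ v β → Σ (EdgeSet HG) λ Q′ → Better Q Q′ × Cleared Q′ v β
  clear-spoke Q geo v β with Q (old v) (new (side β)) in e∈?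
  ... | true  = Removal.result Q geo v β e∈?
  ... | false = Q , (geo , ℕP.≤-refl , λ _ _ → id) , e∈?

  clear-vertex : ∀ Q → LineGeodetic HG Q → ∀ v → Σ (EdgeSet HG) λ Q′ → Better Q Q′ × (∀ γ → Cleared Q′ v γ)
  clear-vertex Q geo v with clear-spoke Q geo v B
  ... | Q₁ , better₁@(geo₁ , _) , cleared-B with clear-spoke Q₁ geo₁ v C
  ...   | Q₂ , better₂@(_ , _ , keeps₂) , cleared-C =
    Q₂ , Better-trans {Q} {Q₁} {Q₂} better₁ better₂ , λ { B → keeps₂ v B cleared-B ; C → cleared-C }

  clear-below : ∀ k → k ≤ m → ∀ Q → LineGeodetic HG Q →
    Σ (EdgeSet HG) λ Q′ → Better Q Q′ × (∀ u → toℕ u < k → ∀ γ → Cleared Q′ u γ)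
  clear-below zero _ Q geo = Q , (geo , ℕP.≤-refl , λ _ _ → id) , λ _ ()
  clear-below (suc k) k<m Q geo with clear-below k (ℕP.<⇒≤ k<m) Q geo
  ... | Qₖ , betterₖ@(geoₖ , _) , clearedₖ with clear-vertex Qₖ geoₖ (fromℕ< k<m)
  ...   | Q′ , better′@(_ , _ , keeps′) , cleared′ =
    Q′ , Better-trans {Q} {Qₖ} {Q′} betterₖ better′ , cleared-upto
    where
    cleared-upto : ∀ u → toℕ u < suc k → ∀ γ → Cleared Q′ u γ
    cleared-upto u (s≤s u≤k) γ with toℕ u ℕP.≟ k
    ... | yes u≡k rewrite FinP.toℕ-injective (trans u≡k (sym (FinP.toℕ-fromℕ< k<m))) = cleared′ γ
    ... | no u≢k = keeps′ u γ (clearedₖ u (ℕP.≤∧≢⇒< u≤k u≢k) γ)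

-- The theorem: a minimum line geodetic set exists because L(H_G) has
-- diameter at most 3, and clearing all its spokes keeps it minimum.
lemma2 : (G : Graph) → TriangleFree G →
    Σ (EdgeSet (H G)) λ Q → MinLineGeodetic (H G) Q × DisjointE' G Q
lemma2 G triangle-free =
  let Q₀ , geo₀ , minimum₀ = minimum-exists (lineGeodetic? 3 diameter)
      Q , (geo , smaller , _) , cleared = clear-below (n G) ℕP.≤-refl Q₀ geo₀
  in Q , (geo , λ S geoS → ℕP.≤-trans smaller (minimum₀ S geoS)) ,
     λ v → cleared v (FinP.toℕ<n v) B , cleared v (FinP.toℕ<n v) C
  where open Exchange G triangle-free
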